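{- Let $s\geqslant2$ and $t$ be coprime positive integers, let $p$ be an $s$-point lying in $\mathcal{R}^s_t$, and let $\lambda$ be the corresponding $s$-core. Then $[\lambda]\subseteq[\kappa_{s,t}]$.
   Context: $P^s=\{p\in\mathbb{R}^s:p_1+\dots+p_s=\binom s2\}$. An $s$-point is a point of $P^s$ with integer coordinates pairwise incongruent mod $s$. The level $t$ rhomboid is $\mathcal{R}^s_t=\{p\in P^s:1\leqslant p_{i+1}-p_i\leqslant t\text{ for }i=1,\dots,s-1\}$. For a partition $\lambda$, $[\lambda]=\{(i,j)\in\mathbb{N}^2:j\leqslant\lambda_i\}$ and the beta-set is $\{\lambda_i-i:i\geqslant1\}$; an $s$-core is a partition with no rim $s$-hook. For an $s$-core $\lambda$ and $r\in\{0,\dots,s-1\}$ let $a_r$ be the smallest integer $\equiv r\pmod s$ not in the beta-set, and $\mathcal{Q}(\lambda)=\{a_0,\dots,a_{s-1}\}$; this is a bijection from $s$-cores onto sets of $s$ integers pairwise incongruent mod $s$ with sum $\binom s2$. The $s$-core corresponding to an $s$-point $p$ is the $\lambda$ with $\mathcal{Q}(\lambda)=\{p_1,\dots,p_s\}$. $\kappa_{s,t}$ is the $s$-core corresponding to the $s$-point $\triangledown$ with coordinates $\triangledown_m=\frac{s-1+t(2m-1-s)}{2}$, $m=1,\dots,s$ (the vertex of $\mathcal{R}^s_t$ opposite $(0,1,\dots,s-1)$). -}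

module Defs where

open import Data.Nat as ℕ using (ℕ; zero; suc; _≤?_)
open import Data.Nat.Combinatorics using (_C_)
open import Data.Integer as ℤ using (ℤ; +_; _-_; _+_; _*_; _<_; _≤_)
open import Data.Integer.DivMod using (_/ℕ_)
open import Data.Integer.Divisibility using (_∣_)
open import Data.Fin using (Fin; toℕ) renaming (zero to fzero; suc to fsuc)
open import Data.List using (List; []; _∷_; filter; length)
open import Data.List.Relation.Unary.All using (All)
open import Data.List.Relation.Unary.Linked using (Linked)
open import Data.Product using (Σ; ∃; _×_)
open import Relation.Binary.PropositionalEquality using (_≡_; _≢_)
open import Relation.Nullary using (¬_)
open import Function.Bundles using (_⇔_)

record Partition : Set where
  constructor mkPartition
  field
    parts    : List ℕ
    positive : All (ℕ._<_ 0) parts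
    decr     : Linked ℕ._≥_ parts
open Partition public

-- λ_i for i ≥ 1 (index i = 1 is the first part); 0 beyond the length.
nth : List ℕ → ℕ → ℕ
nth []       _             = 0
nth (x ∷ xs) zero          = 0      -- index 0 is not used
nth (x ∷ xs) (suc zero)    = x
nth (x ∷ xs) (suc (suc i)) = nth xs (suc i)

part : Partition → ℕ → ℕ
part λ′ i = nth (parts λ′) i

conjPart : Partition → ℕ → ℕ
conjPart λ′ j = length (filter (λ x → j ≤? x) (parts λ′))

InDiagram : Partition → ℕ → ℕ → Set
InDiagram λ′ i j = (1 ℕ.≤ i) × (1 ℕ.≤ j) × (j ℕ.≤ part λ′ i)

_⊆D_ : Partition → Partition → Set
λ′ ⊆D μ = ∀ i j → InDiagram λ′ i j → InDiagram μ i j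

hookLength : Partition → ℕ → ℕ → ℕ
hookLength λ′ i j = (part λ′ i ℕ.∸ j) ℕ.+ (conjPart λ′ j ℕ.∸ i) ℕ.+ 1

-- s-core: no rim s-hook, i.e. no cell of hook length s
IsCore : ℕ → Partition → Set
IsCore s λ′ = ∀ i j → InDiagram λ′ i j → hookLength λ′ i j ≢ s

InBeta : Partition → ℤ → Set
InBeta λ′ x = Σ ℕ λ i → (1 ℕ.≤ i) × (x ≡ + part λ′ i - + i)

InQ : ℕ → Partition → ℤ → Set
InQ s λ′ a = ¬ InBeta λ′ a × (∀ b → b < a → + s ∣ (a - b) → InBeta λ′ b)

-- points of P^s (indexed m = 0,…,s−1 for the paper's 1,…,s)

sumFin : (n : ℕ) → (Fin n → ℤ) → ℤ
sumFin zero    f = + 0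
sumFin (suc n) f = f fzero + sumFin n (λ i → f (fsuc i))

IsSPoint : (s : ℕ) → (Fin s → ℤ) → Set
IsSPoint s p =
  (sumFin s p ≡ + (s C 2)) ×
  (∀ i j → i ≢ j → ¬ (+ s ∣ (p i - p j)))

InRhomboid : (s t : ℕ) → (Fin s → ℤ) → Set
InRhomboid s t p =
  (sumFin s p ≡ + (s C 2)) ×
  (∀ i j → toℕ j ≡ suc (toℕ i) → (+ 1 ≤ p j - p i) × (p j - p i ≤ + t))

Corresponds : (s : ℕ) → (Fin s → ℤ) → Partition → Set
Corresponds s p λ′ = IsCore s λ′ × (∀ a → InQ s λ′ a ⇔ ∃ λ m → p m ≡ a)

-- the vertex ▽, ▽_m = (s − 1 + t(2m − 1 − s))/2, m = 1,…,s
-- (here m = toℕ k + 1; the division is exact when gcd(s,t)=1)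
nabla : (s t : ℕ) → Fin s → ℤ
nabla s t k = (+ s - + 1 + + t * (+ (2 ℕ.* (toℕ k ℕ.+ 1)) - + 1 - + s)) /ℕ 2

-- Suppose κ_i < λ_i and put x = λ_i − i. For an s-point v, the integers z ≥ x lying
-- below some v_m in its residue class number Σ_m ⌊(v_m − x)/s⌋⁺. For v = p they include
-- the i beta-numbers λ_k − k (k ≤ i) of λ, because the beta-set of an s-core is closed
-- under z ↦ z − s and p_m is the least non-beta-number of its class. For v = ▽ they are
-- beta-numbers of κ exceeding κ_i − i, so there are fewer than i of them. But
-- Σ_m ⌊(v_m − x)/s⌋ = −x for every s-point, and ▽_m − p_m increases with m because the
-- steps of p are at most t while those of ▽ equal t. So if the floor for p exceeds the
-- one for ▽ at m and falls short at m′, then m < m′ and the floor for p at m is at most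
-- the one at m′; with equal sums this makes the count for p at most the count for ▽.
module Submission where

open import Defs
open import Data.Nat as ℕ using (ℕ; zero; suc; z≤n; s≤s; _≤?_)
import Data.Nat.Properties as ℕP
open import Data.Nat.Coprimality using (Coprime)
import Data.Nat.Divisibility as ℕ∣
open import Data.Nat.Combinatorics using (_C_; nCk+nC[k+1]≡[n+1]C[k+1]; nC1≡n)
open import Data.Integer as ℤ using (ℤ; +_; -[1+_]; _+_; _-_; _*_; -_; 0ℤ; _≤_; _<_; +≤+; +<+)
import Data.Integer.Properties as ℤP
open import Data.Integer.DivMod using (_/ℕ_; n%ℕd<d; a≡a%ℕn+[a/ℕn]*n; [n/ℕd]*d≤n; n<s[n/ℕd]*d)
open import Data.Integer.Divisibility using (_∣_; divides)
import Data.Integer.Divisibility.Signed as Signed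
open import Data.Integer.Tactic.RingSolver using (solve-∀)
open import Algebra.Properties.AbelianGroup ℤP.+-0-abelianGroup using () renaming (∙-cancelˡ to +-cancelˡ)
open import Algebra.Properties.CommutativeMonoid.Sum ℤP.+-0-commutativeMonoid using (sum; sum-permute)
open import Data.Fin using (Fin; toℕ; fromℕ<; punchOut) renaming (zero to fzero; suc to fsuc)
import Data.Fin.Properties as FP
open import Data.Fin.Permutation using (permutation)
open import Data.List using (List; []; _∷_; _++_; length; filter; applyUpTo; concat; tabulate)
open import Data.List.Properties using (length-++; length-applyUpTo; filter-accept; filter-reject)
open import Data.List.Membership.Propositional using (_∈_)
open import Data.List.Membership.Propositional.Properties
  using (∈-∃++; ∈-++⁻; ∈-++⁺ˡ; ∈-++⁺ʳ; ∈-applyUpTo⁺; ∈-applyUpTo⁻; ∈-tabulate⁺; ∈-tabulate⁻;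
         ∈-concat⁺′; ∈-concat⁻′)
open import Data.List.Relation.Unary.Any using (here; there)
import Data.List.Relation.Unary.All as All
import Data.List.Relation.Unary.All.Properties as Allₚ
import Data.List.Relation.Unary.AllPairs.Properties as AllPairsₚ
open import Data.List.Relation.Unary.Linked as Linked using (Linked; _∷_)
open import Data.List.Relation.Unary.Unique.Propositional using (Unique; _∷_)
import Data.List.Relation.Unary.Unique.Propositional.Properties as Uniqueₚ
open import Data.Product using (∃; _×_; _,_; proj₁; proj₂)
open import Data.Sum using (_⊎_; inj₁; inj₂)
open import Function using (_∘_)
open import Function.Bundles using (Equivalence)
open import Function.Definitions using (Injective)
open import Relation.Binary.Definitions using (tri<; tri≈; tri>)
open import Relation.Binary.PropositionalEquality
open import Relation.Nullary using (¬_; yes; no; contradiction)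
open import Relation.Nullary.Decidable using (_×-dec_)

posPart : ℤ → ℕ
posPart (+ n)    = n
posPart -[1+ n ] = 0

posPart-mono-≤ : ∀ {a b} → a ≤ b → posPart a ℕ.≤ posPart b
posPart-mono-≤ {+ _}       (+≤+ m≤n) = m≤n
posPart-mono-≤ { -[1+ _ ]} _         = z≤n

posPart-nonPos : ∀ {a} → a ≤ 0ℤ → posPart a ≡ 0
posPart-nonPos {+ zero}    _ = refl
posPart-nonPos { -[1+ _ ]} _ = refl
posPart-nonPos {+ suc _}   (+≤+ ())

+posPart-nonNeg : ∀ {a} → 0ℤ ≤ a → + posPart a ≡ a
+posPart-nonNeg (+≤+ _) = refl

+posPart-diff-≤ : ∀ {a b} → b ≤ a → + posPart a - + posPart b ≤ a - b
+posPart-diff-≤ {+ _}       {+ _}       _ = ℤP.≤-refl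
+posPart-diff-≤ {+ m}       { -[1+ n ]} _ = ℤP.+-monoʳ-≤ (+ m) (ℤP.neg-mono-≤ (ℤ.-≤+ {n} {0}))
+posPart-diff-≤ { -[1+ _ ]} { -[1+ _ ]} b≤a = ℤP.i≤j⇒0≤j-i b≤a

<posPart⇒suc≤ : ∀ {q a} → q ℕ.< posPart a → + suc q ≤ a
<posPart⇒suc≤ {a = + _} q<n = +≤+ q<n

suc≤⇒<posPart : ∀ {q a} → + suc q ≤ a → q ℕ.< posPart a
suc≤⇒<posPart (+≤+ q<n) = q<n

pos-∸ : ∀ {m n} → n ℕ.≤ m → + (m ℕ.∸ n) ≡ + m - + n
pos-∸ {m} {n} n≤m = sym (trans (ℤP.m-n≡m⊖n m n) (ℤP.⊖-≥ n≤m))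

-∣i∣≤i : ∀ i → - + ℤ.∣ i ∣ ≤ i
-∣i∣≤i (+ zero)  = ℤP.≤-refl
-∣i∣≤i (+ suc n) = ℤ.-≤+
-∣i∣≤i -[1+ n ]  = ℤP.≤-refl

a-[a-b]≡b : ∀ a b → a - (a - b) ≡ b
a-[a-b]≡b = solve-∀

a-b+b≡a : ∀ a b → a - b + b ≡ a
a-b+b≡a = solve-∀

<⇒0<-diff : ∀ {a b} → a < b → 0ℤ < b - a
<⇒0<-diff {a} {b} a<b = subst (_< b - a) (ℤP.+-inverseʳ a) (ℤP.+-monoˡ-< (- a) a<b)

module _ (d : ℕ) .{{_ : ℕ.NonZero d}} where

  ≤-/ℕ : ∀ k y → k * + d ≤ y → k ≤ y /ℕ d
  ≤-/ℕ k y kd≤y = ℤP.≮⇒≥ λ q<k → ℤP.<-irrefl refl (ℤP.<-≤-trans (n<s[n/ℕd]*d y d)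
    (ℤP.≤-trans (ℤP.*-monoʳ-≤-nonNeg (+ d) (ℤP.i<j⇒suc[i]≤j q<k)) kd≤y))

  /ℕ-monoˡ-≤ : ∀ {y y′} → y ≤ y′ → y /ℕ d ≤ y′ /ℕ d
  /ℕ-monoˡ-≤ {y} {y′} y≤y′ = ≤-/ℕ (y /ℕ d) y′ (ℤP.≤-trans ([n/ℕd]*d≤n y d) y≤y′)

  [k*d]/ℕd≡k : ∀ k → (k * + d) /ℕ d ≡ k
  [k*d]/ℕd≡k k = ℤP.≤-antisym
    (ℤP.*-cancelʳ-≤-pos _ _ (+ d) {{ℤ.positive (+<+ (ℕ.>-nonZero⁻¹ d))}} ([n/ℕd]*d≤n (k * + d) d))
    (≤-/ℕ k _ ℤP.≤-refl)

∣-multiple : ∀ s k → + s ∣ k * + s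
∣-multiple s k = divides ℤ.∣ k ∣ (ℤP.abs-* k (+ s))

∣-diff-sym : ∀ {s} a b → + s ∣ (a - b) → + s ∣ (b - a)
∣-diff-sym {s} a b = subst (s ℕ∣.∣_) (trans (sym (ℤP.∣-i∣≡∣i∣ (a - b))) (cong ℤ.∣_∣ (neg-diff a b)))
  where
  neg-diff : ∀ a b → - (a - b) ≡ b - a
  neg-diff = solve-∀

∣-diff-trans : ∀ {s} a b c → + s ∣ (a - b) → + s ∣ (b - c) → + s ∣ (a - c)
∣-diff-trans {s} a b c s∣a-b s∣b-c = subst (+ s ∣_) (ℤP.+-minus-telescope a b c)
  (Signed.∣⇒∣ᵤ (Signed.∣m∣n⇒∣m+n (Signed.∣ᵤ⇒∣ {+ s} {a - b} s∣a-b) (Signed.∣ᵤ⇒∣ {+ s} {b - c} s∣b-c)))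

∣-nonNeg⇒multiple : ∀ {s z} → 0ℤ ≤ z → + s ∣ z → ∃ λ n → z ≡ + n * + s
∣-nonNeg⇒multiple {s} {+ m} _ (divides n m≡n*s) = n , trans (cong +_ m≡n*s) (ℤP.pos-* n s)

sumFin-cong : ∀ n {f g : Fin n → ℤ} → (∀ k → f k ≡ g k) → sumFin n f ≡ sumFin n g
sumFin-cong zero    _   = refl
sumFin-cong (suc n) f≗g = cong₂ _+_ (f≗g fzero) (sumFin-cong n (f≗g ∘ fsuc))

sumFin-+ : ∀ n (f g : Fin n → ℤ) → sumFin n (λ k → f k + g k) ≡ sumFin n f + sumFin n g
sumFin-+ zero    f g = refl
sumFin-+ (suc n) f g = trans (cong (_+_ (f fzero + g fzero)) (sumFin-+ n (f ∘ fsuc) (g ∘ fsuc)))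
  (interchange (f fzero) (g fzero) _ _)
  where
  interchange : ∀ a b c d → a + b + (c + d) ≡ a + c + (b + d)
  interchange = solve-∀

sumFin-- : ∀ n (f g : Fin n → ℤ) → sumFin n (λ k → f k - g k) ≡ sumFin n f - sumFin n g
sumFin-- zero    f g = refl
sumFin-- (suc n) f g = trans (cong (_+_ (f fzero - g fzero)) (sumFin-- n (f ∘ fsuc) (g ∘ fsuc)))
  (interchange (f fzero) (g fzero) _ _)
  where
  interchange : ∀ a b c d → a - b + (c - d) ≡ a + c - (b + d)
  interchange = solve-∀

sumFin-*ʳ : ∀ n (f : Fin n → ℤ) c → sumFin n (λ k → f k * c) ≡ sumFin n f * c
sumFin-*ʳ zero    f c = sym (ℤP.*-zeroˡ c)
sumFin-*ʳ (suc n) f c = trans (cong (_+_ (f fzero * c)) (sumFin-*ʳ n (f ∘ fsuc) c))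
  (sym (ℤP.*-distribʳ-+ c (f fzero) _))

sumFin-const : ∀ n c → sumFin n (λ _ → c) ≡ + n * c
sumFin-const zero    c = sym (ℤP.*-zeroˡ c)
sumFin-const (suc n) c = trans (cong (_+_ c) (sumFin-const n c)) (sym (ℤP.suc-* (+ n) c))

sumFin-mono-≤ : ∀ n {f g : Fin n → ℤ} → (∀ k → f k ≤ g k) → sumFin n f ≤ sumFin n g
sumFin-mono-≤ zero    _   = ℤP.≤-refl
sumFin-mono-≤ (suc n) f≤g = ℤP.+-mono-≤ (f≤g fzero) (sumFin-mono-≤ n (f≤g ∘ fsuc))

sumFin-toℕ : ∀ n → sumFin n (λ k → + toℕ k) ≡ + (n C 2)
sumFin-toℕ zero    = refl
sumFin-toℕ (suc n) = begin
  + 0 + sumFin n (λ k → + suc (toℕ k))             ≡⟨ ℤP.+-identityˡ _ ⟩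
  sumFin n (λ k → + 1 + + toℕ k)                   ≡⟨ sumFin-+ n (λ _ → + 1) (λ k → + toℕ k) ⟩
  sumFin n (λ _ → + 1) + sumFin n (λ k → + toℕ k)
    ≡⟨ cong₂ _+_ (trans (sumFin-const n (+ 1)) (ℤP.*-identityʳ (+ n))) (sumFin-toℕ n) ⟩
  + n + + (n C 2)                                  ≡⟨ cong (λ m → + m + + (n C 2)) (sym (nC1≡n n)) ⟩
  + (n C 1) + + (n C 2)                            ≡⟨ sym (ℤP.pos-+ (n C 1) (n C 2)) ⟩
  + (n C 1 ℕ.+ n C 2)                              ≡⟨ cong +_ (nCk+nC[k+1]≡[n+1]C[k+1] n 1) ⟩
  + (suc n C 2)                                    ∎
  where open ≡-Reasoning

[nC2]*2≡n*[n-1] : ∀ n → + (n C 2) * + 2 ≡ + n * (+ n - + 1)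
[nC2]*2≡n*[n-1] zero    = refl
[nC2]*2≡n*[n-1] (suc n) = begin
  + (suc n C 2) * + 2                 ≡⟨ cong (λ m → + m * + 2) (sym (nCk+nC[k+1]≡[n+1]C[k+1] n 1)) ⟩
  + (n C 1 ℕ.+ n C 2) * + 2           ≡⟨ cong (λ m → + (m ℕ.+ n C 2) * + 2) (nC1≡n n) ⟩
  + (n ℕ.+ n C 2) * + 2               ≡⟨ cong (_* + 2) (ℤP.pos-+ n (n C 2)) ⟩
  (+ n + + (n C 2)) * + 2             ≡⟨ ℤP.*-distribʳ-+ (+ 2) (+ n) (+ (n C 2)) ⟩
  + n * + 2 + + (n C 2) * + 2         ≡⟨ cong (_+_ (+ n * + 2)) ([nC2]*2≡n*[n-1] n) ⟩
  + n * + 2 + + n * (+ n - + 1)       ≡⟨ pascal (+ n) ⟩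
  (+ 1 + + n) * (+ 1 + + n - + 1)     ≡⟨ cong (λ m → m * (m - + 1)) (sym (ℤP.pos-+ 1 n)) ⟩
  + suc n * (+ suc n - + 1)           ∎
  where
  open ≡-Reasoning
  pascal : ∀ m → m * + 2 + m * (m - + 1) ≡ (+ 1 + m) * (+ 1 + m - + 1)
  pascal = solve-∀

injective⇒surjective : ∀ {n} (f : Fin n → Fin n) → Injective _≡_ _≡_ f → ∀ k → ∃ λ m → f m ≡ k
injective⇒surjective {suc n} f inj k with FP.any? (λ m → f m FP.≟ k)
... | yes hit  = hit
... | no  miss = contradiction (FP.injective⇒≤ punchOut∘f-injective) ℕP.1+n≰n
  where
  punchOut∘f-injective : Injective _≡_ _≡_ (λ m → punchOut {i = k} {j = f m} (λ e → miss (m , sym e)))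
  punchOut∘f-injective {a} {b} e =
    inj (FP.punchOut-injective (λ e′ → miss (a , sym e′)) (λ e′ → miss (b , sym e′)) e)

sum≡sumFin : ∀ n (f : Fin n → ℤ) → sum f ≡ sumFin n f
sum≡sumFin zero    f = refl
sum≡sumFin (suc n) f = cong (_+_ (f fzero)) (sum≡sumFin n (f ∘ fsuc))

sumFin-permute : ∀ n (π : Fin n → Fin n) → Injective _≡_ _≡_ π → (f : Fin n → ℤ) →
  sumFin n (f ∘ π) ≡ sumFin n f
sumFin-permute n π inj f = begin
  sumFin n (f ∘ π)  ≡⟨ sym (sum≡sumFin n (f ∘ π)) ⟩
  sum (f ∘ π)       ≡⟨ sym (sum-permute f (permutation π π⁻¹ π∘π⁻¹ (inj ∘ π∘π⁻¹ ∘ π))) ⟩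
  sum f             ≡⟨ sum≡sumFin n f ⟩
  sumFin n f        ∎
  where
  open ≡-Reasoning
  π⁻¹ : Fin n → Fin n
  π⁻¹ k = proj₁ (injective⇒surjective π inj k)
  π∘π⁻¹ : ∀ k → π (π⁻¹ k) ≡ k
  π∘π⁻¹ k = proj₂ (injective⇒surjective π inj k)

-- Either a⁺ ≤ b⁺ termwise, or some i has b i < a i and 0 < a i; then a k < b k forces
-- 0 < a i ≤ a k, so a⁺ − b⁺ ≤ a − b termwise, whose sum is 0.
sumFin-posPart-≤ : ∀ n (a b : Fin n → ℤ) → sumFin n a ≡ sumFin n b →
  (∀ i j → b i < a i → a j < b j → a i ≤ a j) →
  sumFin n (λ k → + posPart (a k)) ≤ sumFin n (λ k → + posPart (b k))
sumFin-posPart-≤ n a b Σa≡Σb crossing with FP.any? (λ i → (b i ℤP.<? a i) ×-dec (0ℤ ℤP.<? a i))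
... | no none = sumFin-mono-≤ n (λ k → +≤+ (posPart-≤ k))
  where
  posPart-≤ : ∀ k → posPart (a k) ℕ.≤ posPart (b k)
  posPart-≤ k with a k ℤP.≤? b k
  ... | yes ak≤bk = posPart-mono-≤ ak≤bk
  ... | no  ak≰bk = subst (ℕ._≤ posPart (b k))
    (sym (posPart-nonPos (ℤP.≮⇒≥ (λ 0<ak → none (k , ℤP.≰⇒> ak≰bk , 0<ak))))) z≤n
... | yes (i , bi<ai , 0<ai) = ℤP.i-j≤0⇒i≤j (begin
  sumFin n (λ k → + posPart (a k)) - sumFin n (λ k → + posPart (b k))
    ≡⟨ sym (sumFin-- n _ _) ⟩
  sumFin n (λ k → + posPart (a k) - + posPart (b k))
    ≤⟨ sumFin-mono-≤ n termwise ⟩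
  sumFin n (λ k → a k - b k)
    ≡⟨ sumFin-- n a b ⟩
  sumFin n a - sumFin n b
    ≡⟨ ℤP.i≡j⇒i-j≡0 Σa≡Σb ⟩
  0ℤ ∎)
  where
  open ℤP.≤-Reasoning
  termwise : ∀ k → + posPart (a k) - + posPart (b k) ≤ a k - b k
  termwise k with b k ℤP.≤? a k
  ... | yes bk≤ak = +posPart-diff-≤ bk≤ak
  ... | no  bk≰ak = ℤP.≤-reflexive (cong₂ _-_ (+posPart-nonNeg (ℤP.<⇒≤ 0<ak)) (+posPart-nonNeg (ℤP.<⇒≤ 0<bk)))
    where
    0<ak : 0ℤ < a k
    0<ak = ℤP.<-≤-trans 0<ai (crossing i k bi<ai (ℤP.≰⇒> bk≰ak))
    0<bk : 0ℤ < b k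
    0<bk = ℤP.<-trans 0<ak (ℤP.≰⇒> bk≰ak)

+length-concat-tabulate : ∀ {A : Set} n (f : Fin n → List A) →
  + length (concat (tabulate f)) ≡ sumFin n (λ k → + length (f k))
+length-concat-tabulate zero    f = refl
+length-concat-tabulate (suc n) f = trans (cong +_ (length-++ (f fzero)))
  (trans (ℤP.pos-+ (length (f fzero)) _) (cong (_+_ (+ length (f fzero))) (+length-concat-tabulate n (f ∘ fsuc))))

unique-⊆⇒length-≤ : ∀ {A : Set} {xs ys : List A} → Unique xs → (∀ {z} → z ∈ xs → z ∈ ys) →
  length xs ℕ.≤ length ys
unique-⊆⇒length-≤ {xs = []}     _            _    = z≤n
unique-⊆⇒length-≤ {xs = x ∷ xs} (x∉xs ∷ !xs) xs⊆ys with ∈-∃++ (xs⊆ys (here refl))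
... | us , vs , refl = begin
  suc (length xs)            ≤⟨ s≤s (unique-⊆⇒length-≤ !xs xs⊆us++vs) ⟩
  suc (length (us ++ vs))    ≡⟨ cong suc (length-++ us) ⟩
  suc (length us ℕ.+ length vs) ≡⟨ sym (ℕP.+-suc (length us) (length vs)) ⟩
  length us ℕ.+ length (x ∷ vs) ≡⟨ sym (length-++ us) ⟩
  length (us ++ x ∷ vs)      ∎
  where
  open ℕP.≤-Reasoning
  xs⊆us++vs : ∀ {z} → z ∈ xs → z ∈ us ++ vs
  xs⊆us++vs {z} z∈xs with ∈-++⁻ us (xs⊆ys (there z∈xs))
  ... | inj₁ z∈us         = ∈-++⁺ˡ z∈us
  ... | inj₂ (here refl)  = contradiction refl (All.lookup x∉xs z∈xs)
  ... | inj₂ (there z∈vs) = ∈-++⁺ʳ us z∈vs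

-- Beta-numbers of partitions and of s-cores

Decreasing : List ℕ → Set
Decreasing = Linked ℕ._≥_

nth-≤-head : ∀ {x xs} → Decreasing (x ∷ xs) → ∀ l → nth (x ∷ xs) (suc l) ℕ.≤ x
nth-≤-head _                         zero    = ℕP.≤-refl
nth-≤-head {xs = []}     _           (suc l) = z≤n
nth-≤-head {xs = y ∷ ys} (x≥y ∷ dec) (suc l) = ℕP.≤-trans (nth-≤-head dec l) x≥y

nth-antitone : ∀ {xs} → Decreasing xs → ∀ {a b} → a ℕ.≤ b → nth xs (suc b) ℕ.≤ nth xs (suc a)
nth-antitone {[]}         _         _         = z≤n
nth-antitone {x ∷ xs}     dec       {zero} {b} _ = nth-≤-head dec b
nth-antitone {x ∷ []}     _         {suc _} {suc _} _ = z≤n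
nth-antitone {x ∷ y ∷ ys} (_ ∷ dec) {suc _} {suc _} (s≤s a≤b) = nth-antitone dec a≤b

nth-beyond : ∀ xs l → length xs ℕ.< l → nth xs l ≡ 0
nth-beyond []       _             _          = refl
nth-beyond (x ∷ xs) (suc (suc l)) (s≤s len<l) = nth-beyond xs (suc l) len<l

count-≥-none : ∀ {xs j} → Decreasing xs → nth xs 1 ℕ.< j → length (filter (j ≤?_) xs) ≡ 0
count-≥-none {[]}     _   _       = refl
count-≥-none {x ∷ xs} {j} dec x<j rewrite filter-reject (j ≤?_) {x} {xs} (ℕP.<⇒≱ x<j) =
  count-≥-none (Linked.tail dec) (ℕP.≤-<-trans (nth-≤-head dec 1) x<j)

count-≥-between : ∀ {xs j} → Decreasing xs → ∀ k →
  nth xs (suc (suc k)) ℕ.< j → j ℕ.≤ nth xs (suc k) → length (filter (j ≤?_) xs) ≡ suc k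
count-≥-between {[]}         _   _ () z≤n
count-≥-between {x ∷ xs} {j} dec k <j j≤ rewrite filter-accept (j ≤?_) {x} {xs}
  (ℕP.≤-trans j≤ (nth-≤-head dec k)) with k
... | zero   = cong suc (count-≥-none (Linked.tail dec) <j)
... | suc k′ = cong suc (count-≥-between (Linked.tail dec) k′ <j j≤)

beta : Partition → ℕ → ℤ
beta μ l = + part μ l - + l

beta-antitone : ∀ μ {a b} → a ℕ.≤ b → beta μ (suc b) ≤ beta μ (suc a)
beta-antitone μ a≤b = ℤP.+-mono-≤ (+≤+ (nth-antitone (decr μ) a≤b)) (ℤP.neg-mono-≤ (+≤+ (s≤s a≤b)))

beta-strictlyAntitone : ∀ μ {a b} → a ℕ.< b → beta μ (suc b) < beta μ (suc a)
beta-strictlyAntitone μ a<b =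
  ℤP.+-mono-≤-< (+≤+ (nth-antitone (decr μ) (ℕP.<⇒≤ a<b))) (ℤP.neg-mono-< (+<+ (s≤s a<b)))

crosses-level : ∀ (f : ℕ → ℤ) {c} i n → c < f i → f (i ℕ.+ n) ≤ c →
  ∃ λ k → i ℕ.≤ k × c < f k × f (suc k) ≤ c
crosses-level f {c} i zero    c<fi fi≤c =
  contradiction (subst (λ l → f l ≤ c) (ℕP.+-identityʳ i) fi≤c) (ℤP.<⇒≱ c<fi)
crosses-level f {c} i (suc n) c<fi fi+n+1≤c with c ℤP.<? f (i ℕ.+ n)
... | yes c<fi+n = i ℕ.+ n , ℕP.m≤m+n i n , c<fi+n , subst (λ l → f l ≤ c) (ℕP.+-suc i n) fi+n+1≤c
... | no  c≮fi+n = crosses-level f i n c<fi (ℤP.≮⇒≥ c≮fi+n)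

beta-eventually-≤ : ∀ μ i c → ∃ λ n → beta μ (i ℕ.+ n) ≤ c
beta-eventually-≤ μ i c = n , (begin
  + part μ (i ℕ.+ n) - + (i ℕ.+ n) ≡⟨ cong (λ m → + m - + (i ℕ.+ n)) (nth-beyond (parts μ) (i ℕ.+ n) len<i+n) ⟩
  + 0 - + (i ℕ.+ n)                ≡⟨ ℤP.+-identityˡ _ ⟩
  - + (i ℕ.+ n)                    ≤⟨ ℤP.neg-mono-≤ (+≤+ ∣c∣≤i+n) ⟩
  - + ℤ.∣ c ∣                      ≤⟨ -∣i∣≤i c ⟩
  c                                ∎)
  where
  open ℤP.≤-Reasoning
  n : ℕ
  n = suc (length (parts μ) ℕ.+ ℤ.∣ c ∣)
  len<i+n : length (parts μ) ℕ.< i ℕ.+ n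
  len<i+n = ℕP.≤-trans (s≤s (ℕP.m≤m+n _ _)) (ℕP.m≤n+m n i)
  ∣c∣≤i+n : ℤ.∣ c ∣ ℕ.≤ i ℕ.+ n
  ∣c∣≤i+n = ℕP.≤-trans (ℕP.≤-trans (ℕP.m≤n+m _ (length (parts μ))) (ℕP.n≤1+n _)) (ℕP.m≤n+m n i)

gap-hook : ∀ μ {a k c} → a ℕ.≤ k → beta μ (suc (suc k)) < c → c < beta μ (suc k) →
  ∃ λ j → InDiagram μ (suc a) j × + hookLength μ (suc a) j ≡ beta μ (suc a) - c
gap-hook μ {a} {k} {c} a≤k βK+1<c c<βK =
  j , (s≤s z≤n , ℕP.≤-trans (s≤s z≤n) λK+1<j , j≤λa+1) , +hook≡
  where
  K : ℕ
  K = suc k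
  -- Column j = c + K + 1 has length K, because λ_{K+1} < j ≤ λ_K.
  z : ℤ
  z = c + + suc K
  λK+1<z : + part μ (suc K) < z
  λK+1<z = subst (_< z) (a-b+b≡a (+ part μ (suc K)) (+ suc K)) (ℤP.+-monoˡ-< (+ suc K) βK+1<c)
  z≤λK : z ≤ + part μ K
  z≤λK = subst₂ _≤_ (shift c (+ K)) (a-b+b≡a (+ part μ K) (+ K)) (ℤP.+-monoˡ-≤ (+ K) (ℤP.i<j⇒suc[i]≤j c<βK))
    where
    shift : ∀ c l → + 1 + c + l ≡ c + (+ 1 + l)
    shift = solve-∀
  j : ℕ
  j = ℤ.∣ z ∣
  +j≡z : + j ≡ z
  +j≡z = ℤP.0≤i⇒+∣i∣≡i (ℤP.≤-trans (+≤+ z≤n) (ℤP.<⇒≤ λK+1<z))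
  λK+1<j : part μ (suc K) ℕ.< j
  λK+1<j = ℤP.drop‿+<+ (subst (+ part μ (suc K) <_) (sym +j≡z) λK+1<z)
  j≤λK : j ℕ.≤ part μ K
  j≤λK = ℤP.drop‿+≤+ (subst (_≤ + part μ K) (sym +j≡z) z≤λK)
  j≤λa+1 : j ℕ.≤ part μ (suc a)
  j≤λa+1 = ℕP.≤-trans j≤λK (nth-antitone (decr μ) a≤k)
  conj≡K : conjPart μ j ≡ K
  conj≡K = count-≥-between (decr μ) k λK+1<j j≤λK
  +hook≡ : + hookLength μ (suc a) j ≡ beta μ (suc a) - c
  +hook≡ rewrite conj≡K = begin
    + ((part μ (suc a) ℕ.∸ j) ℕ.+ (K ℕ.∸ suc a) ℕ.+ 1)
      ≡⟨ ℤP.pos-+ ((part μ (suc a) ℕ.∸ j) ℕ.+ (K ℕ.∸ suc a)) 1 ⟩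
    + ((part μ (suc a) ℕ.∸ j) ℕ.+ (K ℕ.∸ suc a)) + + 1
      ≡⟨ cong (_+ + 1) (ℤP.pos-+ (part μ (suc a) ℕ.∸ j) (K ℕ.∸ suc a)) ⟩
    + (part μ (suc a) ℕ.∸ j) + + (K ℕ.∸ suc a) + + 1
      ≡⟨ cong₂ (λ u v → u + v + + 1) (pos-∸ j≤λa+1) (pos-∸ (s≤s a≤k)) ⟩
    (+ part μ (suc a) - + j) + (+ K - + suc a) + + 1
      ≡⟨ cong (λ u → (+ part μ (suc a) - u) + (+ K - + suc a) + + 1) +j≡z ⟩
    (+ part μ (suc a) - (c + (+ 1 + + K))) + (+ K - (+ 1 + + a)) + + 1
      ≡⟨ telescope (+ part μ (suc a)) c (+ K) (+ a) ⟩
    (+ part μ (suc a) - (+ 1 + + a)) - c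
      ∎
    where
    open ≡-Reasoning
    telescope : ∀ p c l a → (p - (c + (+ 1 + l))) + (l - (+ 1 + a)) + + 1 ≡ (p - (+ 1 + a)) - c
    telescope = solve-∀

module _ {s : ℕ} .{{_ : ℕ.NonZero s}} {μ : Partition} (core : IsCore s μ) where

  -- The beta-numbers descend from b below b − s; landing on b − s proves the claim,
  -- and jumping over it exhibits a hook of length s.
  InBeta-sub-s : ∀ {b} → InBeta μ b → InBeta μ (b - + s)
  InBeta-sub-s {b} (suc a , _ , refl) =
    closed (crosses-level (beta μ) (suc a) _ c<b (proj₂ (beta-eventually-≤ μ (suc a) c)))
    where
    c : ℤ
    c = b - + s
    c<b : c < b
    c<b = subst (c <_) (ℤP.+-identityʳ b) (ℤP.+-monoʳ-< b (ℤP.neg-mono-< (+<+ (ℕ.>-nonZero⁻¹ s))))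
    closed : (∃ λ k → suc a ℕ.≤ k × c < beta μ k × beta μ (suc k) ≤ c) → InBeta μ c
    closed (suc k , s≤s a≤k , c<βk , βk+1≤c) with beta μ (suc (suc k)) ℤP.≟ c
    ... | yes βk+1≡c = suc (suc k) , s≤s z≤n , sym βk+1≡c
    ... | no  βk+1≢c with gap-hook μ a≤k (ℤP.≤∧≢⇒< βk+1≤c βk+1≢c) c<βk
    ...   | j , cell , +hook≡ =
      contradiction (ℤP.+-injective (trans +hook≡ (a-[a-b]≡b b (+ s)))) (core (suc a) j cell)

  InBeta-sub-ns : ∀ {b} n → InBeta μ b → InBeta μ (b - + n * + s)
  InBeta-sub-ns {b} zero    b∈β = subst (InBeta μ) (sym (b-0*s≡b b (+ s))) b∈β
    where
    b-0*s≡b : ∀ b s → b - + 0 * s ≡ b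
    b-0*s≡b = solve-∀
  InBeta-sub-ns {b} (suc n) b∈β = subst (InBeta μ) (step b (+ n) (+ s)) (InBeta-sub-s (InBeta-sub-ns n b∈β))
    where
    step : ∀ b n s → b - n * s - s ≡ b - (+ 1 + n) * s
    step = solve-∀

-- Residues modulo s

Incongruent : (s : ℕ) → (Fin s → ℤ) → Set
Incongruent s v = ∀ i j → i ≢ j → ¬ (+ s ∣ (v i - v j))

InQ-incongruent : ∀ {s μ a b} → InQ s μ a → InQ s μ b → a ≢ b → ¬ (+ s ∣ (a - b))
InQ-incongruent {a = a} {b} (a∉β , below-a∈β) (b∉β , below-b∈β) a≢b s∣a-b with ℤP.<-cmp a b
... | tri< a<b _ _ = a∉β (below-b∈β a a<b (∣-diff-sym a b s∣a-b))
... | tri≈ _ a≡b _ = a≢b a≡b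
... | tri> _ _ b<a = b∉β (below-a∈β b b<a s∣a-b)

module _ (s : ℕ) .{{_ : ℕ.NonZero s}} where

  residue : ℤ → Fin s
  residue z = fromℕ< (n%ℕd<d z s)

  +residue+quotient : ∀ z → + toℕ (residue z) + (z /ℕ s) * + s ≡ z
  +residue+quotient z = trans (cong (λ r → + r + (z /ℕ s) * + s) (FP.toℕ-fromℕ< (n%ℕd<d z s)))
    (sym (a≡a%ℕn+[a/ℕn]*n z s))

  residue-≡⇒∣ : ∀ a b → residue a ≡ residue b → + s ∣ (a - b)
  residue-≡⇒∣ a b ra≡rb = subst (+ s ∣_) a-b≡ (∣-multiple s (a /ℕ s - b /ℕ s))
    where
    difference : ∀ r q q′ s → (q - q′) * s ≡ (r + q * s) - (r + q′ * s)
    difference = solve-∀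
    a-b≡ : (a /ℕ s - b /ℕ s) * + s ≡ a - b
    a-b≡ = trans (difference (+ toℕ (residue b)) (a /ℕ s) (b /ℕ s) (+ s))
      (cong₂ _-_ (trans (cong (λ r → + toℕ r + (a /ℕ s) * + s) (sym ra≡rb)) (+residue+quotient a))
                 (+residue+quotient b))

  residue-injective : ∀ {v} → Incongruent s v → ∀ x → Injective _≡_ _≡_ (λ m → residue (v m - x))
  residue-injective {v} inc x {i} {j} r≡r with i FP.≟ j
  ... | yes i≡j = i≡j
  ... | no  i≢j = contradiction
    (subst (+ s ∣_) (cancel (v i) (v j) x) (residue-≡⇒∣ (v i - x) (v j - x) r≡r)) (inc i j i≢j)
    where
    cancel : ∀ a b x → (a - x) - (b - x) ≡ a - b
    cancel = solve-∀

  incongruent-covers : ∀ {v} → Incongruent s v → ∀ z → ∃ λ m → + s ∣ (v m - z)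
  incongruent-covers {v} inc z with injective⇒surjective _ (residue-injective {v} inc z) (residue 0ℤ)
  ... | m , r≡r = m , subst (+ s ∣_) (ℤP.+-identityʳ (v m - z)) (residue-≡⇒∣ (v m - z) 0ℤ r≡r)

  sumFin-floor : ∀ {v} → Incongruent s v → ∀ x →
    sumFin s (λ m → (v m - x) /ℕ s) * + s + + (s C 2) ≡ sumFin s v - + s * x
  sumFin-floor {v} inc x = begin
    sumFin s q * + s + + (s C 2)
      ≡⟨ cong₂ _+_ (sym (sumFin-*ʳ s q (+ s))) (sym (sumFin-toℕ s)) ⟩
    sumFin s (λ m → q m * + s) + sumFin s (λ k → + toℕ k)
      ≡⟨ cong (_+_ (sumFin s (λ m → q m * + s))) (sym (sumFin-permute s r (residue-injective {v} inc x) _)) ⟩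
    sumFin s (λ m → q m * + s) + sumFin s (λ m → + toℕ (r m))
      ≡⟨ ℤP.+-comm (sumFin s (λ m → q m * + s)) _ ⟩
    sumFin s (λ m → + toℕ (r m)) + sumFin s (λ m → q m * + s)
      ≡⟨ sym (sumFin-+ s _ _) ⟩
    sumFin s (λ m → + toℕ (r m) + q m * + s)
      ≡⟨ sumFin-cong s (λ m → +residue+quotient (v m - x)) ⟩
    sumFin s (λ m → v m - x)
      ≡⟨ sumFin-- s v (λ _ → x) ⟩
    sumFin s v - sumFin s (λ _ → x)
      ≡⟨ cong (_-_ (sumFin s v)) (sumFin-const s x) ⟩
    sumFin s v - + s * x ∎
    where
    open ≡-Reasoning
    q : Fin s → ℤ
    q m = (v m - x) /ℕ s
    r : Fin s → Fin s
    r m = residue (v m - x)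

  sPoint-sumFin-floor : ∀ {v} → IsSPoint s v → ∀ x → sumFin s (λ m → (v m - x) /ℕ s) ≡ - x
  sPoint-sumFin-floor {v} (Σv≡sC2 , inc) x = ℤP.*-cancelʳ-≡ _ _ (+ s) (begin
    Q * + s                          ≡⟨ add-cancel (Q * + s) (+ (s C 2)) ⟩
    (Q * + s + + (s C 2)) - + (s C 2) ≡⟨ cong (_- + (s C 2)) (sumFin-floor {v} inc x) ⟩
    (sumFin s v - + s * x) - + (s C 2) ≡⟨ cong (λ σ → (σ - + s * x) - + (s C 2)) Σv≡sC2 ⟩
    (+ (s C 2) - + s * x) - + (s C 2) ≡⟨ rearrange (+ (s C 2)) (+ s) x ⟩
    - x * + s                        ∎)
    where
    open ≡-Reasoning
    Q : ℤ
    Q = sumFin s (λ m → (v m - x) /ℕ s)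
    add-cancel : ∀ a b → a ≡ (a + b) - b
    add-cancel = solve-∀
    rearrange : ∀ c s x → (c - s * x) - c ≡ - x * s
    rearrange = solve-∀

  classBelow : ℤ → ℤ → List ℤ
  classBelow a x = applyUpTo (λ q → a - + suc q * + s) (posPart ((a - x) /ℕ s))

  ∈-classBelow⁻ : ∀ a x {z} → z ∈ classBelow a x → x ≤ z × z < a × + s ∣ (a - z)
  ∈-classBelow⁻ a x z∈ with ∈-applyUpTo⁻ (λ q → a - + suc q * + s) z∈
  ... | q , q<⌊⌋ , refl = x≤z , z<a , subst (+ s ∣_) (sym (a-[a-b]≡b a _)) (∣-multiple s (+ suc q))
    where
    [q+1]s≤a-x : + suc q * + s ≤ a - x
    [q+1]s≤a-x = ℤP.≤-trans (ℤP.*-monoʳ-≤-nonNeg (+ s) (<posPart⇒suc≤ {a = (a - x) /ℕ s} q<⌊⌋))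
      ([n/ℕd]*d≤n (a - x) s)
    x≤z : x ≤ a - + suc q * + s
    x≤z = subst₂ _≤_ (swap₁ x (+ suc q * + s)) (swap₂ a x (+ suc q * + s))
      (ℤP.+-monoˡ-≤ (x - + suc q * + s) [q+1]s≤a-x)
      where
      swap₁ : ∀ x d → d + (x - d) ≡ x
      swap₁ = solve-∀
      swap₂ : ∀ a x d → a - x + (x - d) ≡ a - d
      swap₂ = solve-∀
    z<a : a - + suc q * + s < a
    z<a = subst (a - + suc q * + s <_) (ℤP.+-identityʳ a)
      (ℤP.+-monoʳ-< a (ℤP.neg-mono-< (subst (0ℤ <_) (ℤP.pos-* (suc q) s)
        (+<+ (ℕ.>-nonZero⁻¹ (suc q ℕ.* s) {{ℕP.m*n≢0 (suc q) s}})))))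

  ∈-classBelow⁺ : ∀ {a x z} → x ≤ z → z < a → + s ∣ (a - z) → z ∈ classBelow a x
  ∈-classBelow⁺ {a} {x} {z} x≤z z<a s∣a-z with ∣-nonNeg⇒multiple (ℤP.<⇒≤ (<⇒0<-diff z<a)) s∣a-z
  ... | zero  , a-z≡0 = contradiction (sym (trans a-z≡0 (ℤP.*-zeroˡ (+ s)))) (ℤP.<⇒≢ (<⇒0<-diff z<a))
  ... | suc q , a-z≡ = subst (_∈ classBelow a x) (sym z≡)
    (∈-applyUpTo⁺ (λ q → a - + suc q * + s) (suc≤⇒<posPart (≤-/ℕ s (+ suc q) (a - x) [q+1]s≤a-x)))
    where
    z≡ : z ≡ a - + suc q * + s
    z≡ = trans (sym (a-[a-b]≡b a z)) (cong (_-_ a) a-z≡)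
    [q+1]s≤a-x : + suc q * + s ≤ a - x
    [q+1]s≤a-x = subst (_≤ a - x) a-z≡ (ℤP.+-monoʳ-≤ a (ℤP.neg-mono-≤ x≤z))

  classBelow-unique : ∀ a x → Unique (classBelow a x)
  classBelow-unique a x = Uniqueₚ.applyUpTo⁺₁ _ _ (λ i<j _ eq → ℕP.<⇒≢ i<j
    (ℕP.suc-injective (ℤP.+-injective (ℤP.*-cancelʳ-≡ _ _ (+ s) (cancel a _ _ eq)))))
    where
    cancel : ∀ a d e → a - d ≡ a - e → d ≡ e
    cancel a d e eq = trans (sym (a-[a-b]≡b a d)) (trans (cong (_-_ a) eq) (a-[a-b]≡b a e))

  classesBelow : (Fin s → ℤ) → ℤ → List ℤ
  classesBelow v x = concat (tabulate (λ m → classBelow (v m) x))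

  ∈-classesBelow⁻ : ∀ {v x z} → z ∈ classesBelow v x → ∃ λ m → x ≤ z × z < v m × + s ∣ (v m - z)
  ∈-classesBelow⁻ {v} {x} z∈ with ∈-concat⁻′ (tabulate (λ m → classBelow (v m) x)) z∈
  ... | _ , z∈xs , xs∈ with ∈-tabulate⁻ xs∈
  ...   | m , refl = m , ∈-classBelow⁻ (v m) x z∈xs

  ∈-classesBelow⁺ : ∀ {v x z} m → x ≤ z → z < v m → + s ∣ (v m - z) → z ∈ classesBelow v x
  ∈-classesBelow⁺ {v} {x} m x≤z z<vm s∣ =
    ∈-concat⁺′ (∈-classBelow⁺ x≤z z<vm s∣) (∈-tabulate⁺ {f = λ m → classBelow (v m) x} m)

  classesBelow-unique : ∀ {v} → Incongruent s v → ∀ x → Unique (classesBelow v x)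
  classesBelow-unique {v} inc x = Uniqueₚ.concat⁺ (Allₚ.tabulate⁺ (λ m → classBelow-unique (v m) x))
    (AllPairsₚ.tabulate⁺ disjoint)
    where
    disjoint : ∀ {i j} → i ≢ j → ∀ {z} → ¬ (z ∈ classBelow (v i) x × z ∈ classBelow (v j) x)
    disjoint {i} {j} i≢j {z} (z∈i , z∈j) = inc i j i≢j
      (∣-diff-trans (v i) z (v j) (proj₂ (proj₂ (∈-classBelow⁻ (v i) x z∈i)))
        (∣-diff-sym (v j) z (proj₂ (proj₂ (∈-classBelow⁻ (v j) x z∈j)))))

  +length-classesBelow : ∀ v x → + length (classesBelow v x) ≡ sumFin s (λ m → + posPart ((v m - x) /ℕ s))
  +length-classesBelow v x = trans (+length-concat-tabulate s _)
    (sumFin-cong s (λ m → cong +_ (length-applyUpTo _ (posPart ((v m - x) /ℕ s)))))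

  module _ (μ : Partition) (v : Fin s → ℤ) (inc : Incongruent s v) (v∈Q : ∀ m → InQ s μ (v m)) where

    InBeta⇒below-congruent : IsCore s μ → ∀ {z} → InBeta μ z → ∃ λ m → z < v m × + s ∣ (v m - z)
    InBeta⇒below-congruent core {z} z∈β with incongruent-covers {v} inc z
    ... | m , s∣vm-z with z ℤP.<? v m
    ...   | yes z<vm = m , z<vm , s∣vm-z
    ...   | no  z≮vm with ∣-nonNeg⇒multiple (ℤP.i≤j⇒0≤j-i (ℤP.≮⇒≥ z≮vm)) (∣-diff-sym (v m) z s∣vm-z)
    ...     | n , z-vm≡ns = contradiction
      (subst (InBeta μ) z-ns≡vm (InBeta-sub-ns {s = s} {μ = μ} core n z∈β)) (proj₁ (v∈Q m))
      where
      z-ns≡vm : z - + n * + s ≡ v m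
      z-ns≡vm = trans (cong (_-_ z) (sym z-vm≡ns)) (a-[a-b]≡b z (v m))

    length-classesBelow-≤ : ∀ {n x} → beta μ (suc n) < x → length (classesBelow v x) ℕ.≤ n
    length-classesBelow-≤ {n} {x} β<x = subst (length (classesBelow v x) ℕ.≤_) (length-applyUpTo _ n)
      (unique-⊆⇒length-≤ (classesBelow-unique {v} inc x) ⊆betas)
      where
      ⊆betas : ∀ {z} → z ∈ classesBelow v x → z ∈ applyUpTo (λ l → beta μ (suc l)) n
      ⊆betas z∈ with ∈-classesBelow⁻ {v} z∈
      ... | m , x≤z , z<vm , s∣vm-z with proj₂ (v∈Q m) _ z<vm s∣vm-z
      ...   | suc l , _ , refl = ∈-applyUpTo⁺ (λ l → beta μ (suc l)) (ℕP.≰⇒> λ n≤l →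
        ℤP.<⇒≱ (ℤP.<-≤-trans β<x x≤z) (beta-antitone μ n≤l))

    ≤-length-classesBelow : IsCore s μ → ∀ {n x} → x ≤ beta μ (suc n) → suc n ℕ.≤ length (classesBelow v x)
    ≤-length-classesBelow core {n} {x} x≤β = subst (ℕ._≤ length (classesBelow v x))
      (length-applyUpTo (λ l → beta μ (suc l)) (suc n)) (unique-⊆⇒length-≤ betas-unique betas⊆)
      where
      betas-unique : Unique (applyUpTo (λ l → beta μ (suc l)) (suc n))
      betas-unique = Uniqueₚ.applyUpTo⁺₁ _ (suc n) (λ i<j _ eq → ℤP.<-irrefl (sym eq) (beta-strictlyAntitone μ i<j))
      betas⊆ : ∀ {z} → z ∈ applyUpTo (λ l → beta μ (suc l)) (suc n) → z ∈ classesBelow v x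
      betas⊆ z∈ with ∈-applyUpTo⁻ (λ l → beta μ (suc l)) z∈
      ... | l , l<n+1 , refl with InBeta⇒below-congruent core (suc l , s≤s z≤n , refl)
      ...   | m , z<vm , s∣vm-z =
        ∈-classesBelow⁺ {v} m (ℤP.≤-trans x≤β (beta-antitone μ (ℕ.s≤s⁻¹ l<n+1))) z<vm s∣vm-z

  length-classesBelow-mono : ∀ u v → IsSPoint s u → IsSPoint s v →
    (∀ i j → v i < u i → u j < v j → u i ≤ u j) →
    ∀ x → length (classesBelow u x) ℕ.≤ length (classesBelow v x)
  length-classesBelow-mono u v u-pt v-pt crossing x = ℤP.drop‿+≤+ (begin
    + length (classesBelow u x)                     ≡⟨ +length-classesBelow u x ⟩
    sumFin s (λ m → + posPart ((u m - x) /ℕ s))     ≤⟨ sumFin-posPart-≤ s _ _ same-sum floor-crossing ⟩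
    sumFin s (λ m → + posPart ((v m - x) /ℕ s))     ≡⟨ sym (+length-classesBelow v x) ⟩
    + length (classesBelow v x)                     ∎)
    where
    open ℤP.≤-Reasoning
    floor-mono : ∀ {a b} → a ≤ b → (a - x) /ℕ s ≤ (b - x) /ℕ s
    floor-mono a≤b = /ℕ-monoˡ-≤ s (ℤP.+-monoˡ-≤ (- x) a≤b)
    same-sum : sumFin s (λ m → (u m - x) /ℕ s) ≡ sumFin s (λ m → (v m - x) /ℕ s)
    same-sum = trans (sPoint-sumFin-floor {u} u-pt x) (sym (sPoint-sumFin-floor {v} v-pt x))
    floor-crossing : ∀ i j → (v i - x) /ℕ s < (u i - x) /ℕ s → (u j - x) /ℕ s < (v j - x) /ℕ s →
      (u i - x) /ℕ s ≤ (u j - x) /ℕ s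
    floor-crossing i j <i <j = floor-mono (crossing i j
      (ℤP.≰⇒> (λ ui≤vi → ℤP.<⇒≱ <i (floor-mono ui≤vi)))
      (ℤP.≰⇒> (λ vj≤uj → ℤP.<⇒≱ <j (floor-mono vj≤uj))))

-- The rhomboid and its vertex

stepwise-monotone : ∀ {n} (h : Fin n → ℤ) → (∀ i j → toℕ j ≡ suc (toℕ i) → h i ≤ h j) →
  ∀ i j → toℕ i ℕ.≤ toℕ j → h i ≤ h j
stepwise-monotone h step fzero    fzero           _         = ℤP.≤-refl
stepwise-monotone h step fzero    (fsuc fzero)    _         = step fzero (fsuc fzero) refl
stepwise-monotone h step fzero    (fsuc (fsuc j)) _         = ℤP.≤-trans (step fzero (fsuc fzero) refl)
  (stepwise-monotone (h ∘ fsuc) (λ i j → step (fsuc i) (fsuc j) ∘ cong suc) fzero (fsuc j) z≤n)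
stepwise-monotone h step (fsuc i) (fsuc j)        (s≤s i≤j) =
  stepwise-monotone (h ∘ fsuc) (λ i j → step (fsuc i) (fsuc j) ∘ cong suc) i j i≤j

module _ {s t : ℕ} {p : Fin s → ℤ} (rh : InRhomboid s t p) where

  rhomboid-increasing : ∀ i j → toℕ i ℕ.< toℕ j → p i < p j
  rhomboid-increasing i j i<j = begin-strict
    p i                           ≡⟨ sym (a-b+b≡a (p i) (+ toℕ i)) ⟩
    p i - + toℕ i + + toℕ i       ≤⟨ ℤP.+-monoˡ-≤ (+ toℕ i) (stepwise-monotone h step i j (ℕP.<⇒≤ i<j)) ⟩
    p j - + toℕ j + + toℕ i       <⟨ ℤP.+-monoʳ-< (p j - + toℕ j) (+<+ i<j) ⟩
    p j - + toℕ j + + toℕ j       ≡⟨ a-b+b≡a (p j) (+ toℕ j) ⟩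
    p j                           ∎
    where
    open ℤP.≤-Reasoning
    h : Fin s → ℤ
    h k = p k - + toℕ k
    step : ∀ i j → toℕ j ≡ suc (toℕ i) → h i ≤ h j
    step i j j≡i+1 = ℤP.0≤i-j⇒j≤i (subst (0ℤ ≤_) h-difference (ℤP.i≤j⇒0≤j-i (proj₁ (proj₂ rh i j j≡i+1))))
      where
      regroup : ∀ a b m → a - b - + 1 ≡ (a - (+ 1 + m)) - (b - m)
      regroup = solve-∀
      h-difference : p j - p i - + 1 ≡ h j - h i
      h-difference = trans (regroup (p j) (p i) (+ toℕ i)) (cong (λ e → (p j - + e) - h i) (sym j≡i+1))

  rhomboid-crossing : ∀ {w : Fin s → ℤ} → (∀ i j → toℕ j ≡ suc (toℕ i) → w j - w i ≡ + t) →
    ∀ i j → w i < p i → p j < w j → p i ≤ p j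
  rhomboid-crossing {w} w-step i j wi<pi pj<wj with toℕ j ℕP.≤? toℕ i
  ... | no  j≰i = ℤP.<⇒≤ (rhomboid-increasing i j (ℕP.≰⇒> j≰i))
  ... | yes j≤i = contradiction (stepwise-monotone h step j i j≤i) (ℤP.<⇒≱ (ℤP.<-trans hi<0 0<hj))
    where
    h : Fin s → ℤ
    h k = w k - p k
    hi<0 : h i < 0ℤ
    hi<0 = subst (h i <_) (ℤP.+-inverseʳ (p i)) (ℤP.+-monoˡ-< (- p i) wi<pi)
    0<hj : 0ℤ < h j
    0<hj = <⇒0<-diff pj<wj
    step : ∀ i j → toℕ j ≡ suc (toℕ i) → h i ≤ h j
    step i j j≡i+1 = ℤP.0≤i-j⇒j≤i (subst (0ℤ ≤_) (trans (cong (_- (p j - p i)) (sym (w-step i j j≡i+1)))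
      (regroup (w j) (w i) (p j) (p i))) (ℤP.i≤j⇒0≤j-i (proj₂ (proj₂ rh i j j≡i+1))))
      where
      regroup : ∀ a b c d → (a - b) - (c - d) ≡ (a - c) - (b - d)
      regroup = solve-∀

even⊎odd : ∀ n → ∃ λ u → n ≡ u ℕ.* 2 ⊎ n ≡ suc (u ℕ.* 2)
even⊎odd zero    = 0 , inj₁ refl
even⊎odd (suc n) with even⊎odd n
... | u , inj₁ n≡2u   = u , inj₂ (cong suc n≡2u)
... | u , inj₂ n≡2u+1 = suc u , inj₁ (cong suc n≡2u+1)

coprime⇒even-[s-1]*[1-t] : ∀ {s t} → Coprime s t → ∃ λ c → c * + 2 ≡ (+ s - + 1) * (+ 1 - + t)
coprime⇒even-[s-1]*[1-t] {s} {t} coprime with even⊎odd s | even⊎odd t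
... | u , inj₂ refl | _ =
  + u * (+ 1 - + t) , trans (odd (+ u) (+ t))
    (cong (λ e → (+ 1 + e - + 1) * (+ 1 - + t)) (sym (ℤP.pos-* u 2)))
  where
  odd : ∀ u t → u * (+ 1 - t) * + 2 ≡ (+ 1 + u * + 2 - + 1) * (+ 1 - t)
  odd = solve-∀
... | u , inj₁ refl | w , inj₂ refl =
  - ((+ (u ℕ.* 2) - + 1) * + w) , trans (odd (+ (u ℕ.* 2)) (+ w))
    (cong (λ e → (+ (u ℕ.* 2) - + 1) * (+ 1 - (+ 1 + e))) (sym (ℤP.pos-* w 2)))
  where
  odd : ∀ s w → - ((s - + 1) * w) * + 2 ≡ (s - + 1) * (+ 1 - (+ 1 + w * + 2))
  odd = solve-∀
... | u , inj₁ refl | w , inj₁ refl = contradiction (coprime (ℕ∣.divides u refl , ℕ∣.divides w refl)) λ ()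

module Vertex (s t : ℕ) {c : ℤ} (hc : c * + 2 ≡ (+ s - + 1) * (+ 1 - + t)) where

  nabla≡ : ∀ k → nabla s t k ≡ c + + t * + toℕ k
  nabla≡ k = trans (cong (λ e → e /ℕ 2) numerator≡) ([k*d]/ℕd≡k 2 (c + + t * + toℕ k))
    where
    open ≡-Reasoning
    regroup : ∀ s t k → s - + 1 + t * (+ 2 * (k + + 1) - + 1 - s) ≡ (s - + 1) * (+ 1 - t) + t * k * + 2
    regroup = solve-∀
    numerator≡ : + s - + 1 + + t * (+ (2 ℕ.* (toℕ k ℕ.+ 1)) - + 1 - + s) ≡ (c + + t * + toℕ k) * + 2
    numerator≡ = begin
      + s - + 1 + + t * (+ (2 ℕ.* (toℕ k ℕ.+ 1)) - + 1 - + s)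
        ≡⟨ cong (λ e → + s - + 1 + + t * (e - + 1 - + s))
             (trans (ℤP.pos-* 2 (toℕ k ℕ.+ 1)) (cong (_*_ (+ 2)) (ℤP.pos-+ (toℕ k) 1))) ⟩
      + s - + 1 + + t * (+ 2 * (+ toℕ k + + 1) - + 1 - + s)
        ≡⟨ regroup (+ s) (+ t) (+ toℕ k) ⟩
      (+ s - + 1) * (+ 1 - + t) + + t * + toℕ k * + 2
        ≡⟨ cong (_+ + t * + toℕ k * + 2) (sym hc) ⟩
      c * + 2 + + t * + toℕ k * + 2
        ≡⟨ sym (ℤP.*-distribʳ-+ (+ 2) c _) ⟩
      (c + + t * + toℕ k) * + 2 ∎

  sumFin-nabla : sumFin s (nabla s t) ≡ + (s C 2)
  sumFin-nabla = ℤP.*-cancelʳ-≡ _ _ (+ 2) (begin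
    sumFin s (nabla s t) * + 2
      ≡⟨ cong (_* + 2) (sumFin-cong s nabla≡) ⟩
    sumFin s (λ k → c + + t * + toℕ k) * + 2
      ≡⟨ cong (_* + 2) (sumFin-+ s (λ _ → c) (λ k → + t * + toℕ k)) ⟩
    (sumFin s (λ _ → c) + sumFin s (λ k → + t * + toℕ k)) * + 2
      ≡⟨ cong (λ e → (e + sumFin s (λ k → + t * + toℕ k)) * + 2) (sumFin-const s c) ⟩
    (+ s * c + sumFin s (λ k → + t * + toℕ k)) * + 2
      ≡⟨ cong (λ e → (+ s * c + e) * + 2)
           (trans (sumFin-cong s (λ k → ℤP.*-comm (+ t) (+ toℕ k))) (sumFin-*ʳ s (λ k → + toℕ k) (+ t))) ⟩
    (+ s * c + sumFin s (λ k → + toℕ k) * + t) * + 2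
      ≡⟨ cong (λ e → (+ s * c + e * + t) * + 2) (sumFin-toℕ s) ⟩
    (+ s * c + + (s C 2) * + t) * + 2
      ≡⟨ expand (+ s) c (+ (s C 2)) (+ t) ⟩
    + s * (c * + 2) + (+ (s C 2) * + 2) * + t
      ≡⟨ cong₂ (λ e f → + s * e + f * + t) hc ([nC2]*2≡n*[n-1] s) ⟩
    + s * ((+ s - + 1) * (+ 1 - + t)) + (+ s * (+ s - + 1)) * + t
      ≡⟨ collapse (+ s) (+ t) ⟩
    + s * (+ s - + 1)
      ≡⟨ sym ([nC2]*2≡n*[n-1] s) ⟩
    + (s C 2) * + 2 ∎)
    where
    open ≡-Reasoning
    expand : ∀ s c b t → (s * c + b * t) * + 2 ≡ s * (c * + 2) + (b * + 2) * t
    expand = solve-∀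
    collapse : ∀ s t → s * ((s - + 1) * (+ 1 - t)) + (s * (s - + 1)) * t ≡ s * (s - + 1)
    collapse = solve-∀

  nabla-step : ∀ i j → toℕ j ≡ suc (toℕ i) → nabla s t j - nabla s t i ≡ + t
  nabla-step i j j≡i+1 = begin
    nabla s t j - nabla s t i                       ≡⟨ cong₂ _-_ (nabla≡ j) (nabla≡ i) ⟩
    c + + t * + toℕ j - (c + + t * + toℕ i)         ≡⟨ cong (λ e → c + + t * + e - (c + + t * + toℕ i)) j≡i+1 ⟩
    c + + t * (+ 1 + + toℕ i) - (c + + t * + toℕ i) ≡⟨ difference c (+ t) (+ toℕ i) ⟩
    + t                                             ∎
    where
    open ≡-Reasoning
    difference : ∀ c t i → c + t * (+ 1 + i) - (c + t * i) ≡ t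
    difference = solve-∀

  nabla-injective : ℕ.NonZero t → ∀ {i j} → nabla s t i ≡ nabla s t j → i ≡ j
  nabla-injective t≢0 {i} {j} ▽i≡▽j = FP.toℕ-injective (ℤP.+-injective
    (ℤP.*-cancelˡ-≡ (+ t) _ _ {{t≢0}} (+-cancelˡ c _ _ (trans (sym (nabla≡ i)) (trans ▽i≡▽j (nabla≡ j))))))

proposition5p5 : (s t : ℕ) → 2 ℕ.≤ s → 0 ℕ.< t → Coprime s t →
    (p : Fin s → ℤ) → IsSPoint s p → InRhomboid s t p →
    (λ′ κ : Partition) → Corresponds s p λ′ → Corresponds s (nabla s t) κ →
    λ′ ⊆D κ
proposition5p5 zero      _ ()
proposition5p5 (suc _)   _ _ _ _ _ _ _ _ _ _ _ zero    _ (() , _)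
proposition5p5 s@(suc _) t _ 0<t coprime p p-pt rh λ′ κ (λ′-core , Q[λ′]) (_ , Q[κ]) (suc n) j (1≤i , 1≤j , j≤λ′ᵢ) =
  1≤i , 1≤j , ℕP.≤-trans j≤λ′ᵢ (ℕP.≮⇒≥ no-excess)
  where
  half : ∃ λ c → c * + 2 ≡ (+ s - + 1) * (+ 1 - + t)
  half = coprime⇒even-[s-1]*[1-t] coprime
  open Vertex s t {proj₁ half} (proj₂ half)
  ▽ : Fin s → ℤ
  ▽ = nabla s t
  p∈Q : ∀ m → InQ s λ′ (p m)
  p∈Q m = Equivalence.from (Q[λ′] (p m)) (m , refl)
  ▽∈Q : ∀ m → InQ s κ (▽ m)
  ▽∈Q m = Equivalence.from (Q[κ] (▽ m)) (m , refl)
  ▽-pt : IsSPoint s ▽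
  ▽-pt = sumFin-nabla , λ i j i≢j →
    InQ-incongruent {s} {κ} (▽∈Q i) (▽∈Q j) (i≢j ∘ nabla-injective (ℕ.>-nonZero 0<t))
  no-excess : ¬ (part κ (suc n) ℕ.< part λ′ (suc n))
  no-excess κᵢ<λ′ᵢ = ℕP.<-irrefl refl (begin-strict
    n                           <⟨ ℕP.n<1+n n ⟩
    suc n                       ≤⟨ ≤-length-classesBelow s λ′ p (proj₂ p-pt) p∈Q λ′-core ℤP.≤-refl ⟩
    length (classesBelow s p x) ≤⟨ length-classesBelow-mono s p ▽ p-pt ▽-pt (rhomboid-crossing rh nabla-step) x ⟩
    length (classesBelow s ▽ x) ≤⟨ length-classesBelow-≤ s κ ▽ (proj₂ ▽-pt) ▽∈Q βκ<x ⟩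
    n                           ∎)
    where
    open ℕP.≤-Reasoning
    x : ℤ
    x = beta λ′ (suc n)
    βκ<x : beta κ (suc n) < x
    βκ<x = ℤP.+-monoˡ-< (- + suc n) (+<+ κᵢ<λ′ᵢ)
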